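{- Let $F=(k_F)_{k\ge 0}$ be a sequence of positive integers with $0_F=1$, let $\Pi$ be the $F$-cobweb poset with levels $\Phi_0=\{\hat 0\},\Phi_1,\Phi_2,\dots$, $|\Phi_k|=k_F$, and for $n\ge 0$ let $P_n=\Phi_0\cup\cdots\cup\Phi_n$ with the induced order. Then the characteristic polynomial of $P_n$ is $$\chi_{P_n}(t)=t^n+\sum_{k=1}^{n}(-1)^k\,k_F\,t^{\,n-k}\prod_{r=1}^{k-1}(r_F-1),$$ where empty products equal $1$.
   Context: An $F$-cobweb poset is a partially ordered set $\Pi=(\Phi,\le)$ whose ground set is the disjoint union $\Phi=\bigcup_{k\ge 0}\Phi_k$ of finite nonempty sets (levels) with $|\Phi_k|=k_F$, in which each level is an antichain and, for $x\in\Phi_r$, $y\in\Phi_s$ with $r\neq s$, one has $x<y$ if and only if $r<s$. The rank of $x$ is $r(x)=r$ if $x\in\Phi_r$. $\mu$ denotes the Möbius function ($\mu(x,x)=1$, $\mu(x,y)=-\sum_{x\le z<y}\mu(x,z)$ for $x<y$). The characteristic polynomial is $\chi_{P_n}(t)=\sum_{x\in P_n}\mu(\hat 0,x)\,t^{\,n-r(x)}$. -}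

module Defs where

open import Data.Nat as ℕ using (ℕ; zero; suc; _∸_; _<_; _<?_)
open import Data.Integer as ℤ using (ℤ; +_; -_; _+_; _*_; _-_; _^_)
open import Data.Fin using (Fin)
import Data.Fin.Properties as FinP
import Data.Nat.Properties as ℕP
open import Data.List using (List; []; _∷_; map; foldr; concatMap; upTo; allFin; length)
open import Data.Product using (Σ; _,_; proj₁)
import Data.Product.Properties as ΣP
open import Data.Sum using (_⊎_)
open import Relation.Nullary using (Dec; yes; no; ¬_)
open import Relation.Nullary.Decidable using (_⊎-dec_; _×-dec_; ¬?)
open import Relation.Binary.PropositionalEquality using (_≡_; subst; sym)
open import Relation.Binary.Definitions using (DecidableEquality)

sumℤ : List ℤ → ℤ
sumℤ = foldr _+_ (+ 0)

prodℤ : List ℤ → ℤ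
prodℤ = foldr _*_ (+ 1)

filterD : {A : Set} {P : A → Set} → ((a : A) → Dec (P a)) → List A → List A
filterD p [] = []
filterD p (a ∷ as) with p a
... | yes _ = a ∷ filterD p as
... | no  _ = filterD p as

-- The recursion is on a fuel parameter; with fuel = number of elements
-- (≥ length of every strict chain) it computes the Möbius function exactly.
module Mobius {A : Set} (_≟_ : DecidableEquality A)
              (_≤_ : A → A → Set) (_≤?_ : (a b : A) → Dec (a ≤ b))
              (elems : List A) where

  μ-fuel : ℕ → A → A → ℤ
  μ-fuel zero x y = + 0
  μ-fuel (suc f) x y with x ≟ y
  ... | yes _ = + 1
  ... | no _ with x ≤? y
  ...   | no _ = + 0
  ...   | yes _ = - sumℤ (map (μ-fuel f x)
                      (filterD (λ z → (x ≤? z) ×-dec ((z ≤? y) ×-dec ¬? (z ≟ y))) elems))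

  μ : A → A → ℤ
  μ = μ-fuel (length elems)

-- The F-cobweb poset Π: elements are pairs (k , i) with i ∈ Φ_k = Fin (F k).
module Cobweb (F : ℕ → ℕ) where

  Elem : Set
  Elem = Σ ℕ (λ k → Fin (F k))

  rank : Elem → ℕ
  rank = proj₁

  _≤Π_ : Elem → Elem → Set
  x ≤Π y = (rank x < rank y) ⊎ (x ≡ y)

  _≟Π_ : DecidableEquality Elem
  _≟Π_ = ΣP.≡-dec ℕP._≟_ FinP._≟_

  _≤Π?_ : (x y : Elem) → Dec (x ≤Π y)
  x ≤Π? y = (rank x <? rank y) ⊎-dec (x ≟Π y)

  elemsP : ℕ → List Elem
  elemsP n = concatMap (λ k → map (λ i → (k , i)) (allFin (F k))) (upTo (suc n))

  μP : ℕ → Elem → Elem → ℤ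
  μP n = Mobius.μ _≟Π_ _≤Π_ _≤Π?_ (elemsP n)

  bot : F 0 ≡ 1 → Elem
  bot e = (0 , subst Fin (sym e) Fin.zero)
    where import Data.Fin as Fin

  χ : F 0 ≡ 1 → ℕ → ℤ → ℤ
  χ e n t = sumℤ (map (λ x → μP n (bot e) x * (t ^ (n ∸ rank x))) (elemsP n))

  rhs : ℕ → ℤ → ℤ
  rhs n t = (t ^ n) + sumℤ (map term (map suc (upTo n)))
    where
      term : ℕ → ℤ
      term k = (((- + 1) ^ k) * (+ F k)) * ((t ^ (n ∸ k))
               * prodℤ (map (λ r → + F r - + 1) (map suc (upTo (k ∸ 1)))))

-- Write π k = Π_{r=1}^{k-1} (r_F - 1) and m k = (-1)^k π k.  The heart of
-- the proof is that the Möbius function from the bottom is constant on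
-- levels:  μ(0̂, x) = m (rank x).  Since every element of rank < k lies
-- strictly below every element of rank k, the defining recursion of μ at
-- an element of rank k+1 sums μ(0̂, ·) over all of Φ_0 ∪ … ∪ Φ_k, i.e. it
-- reads  μ = - Σ_{j ≤ k} j_F m j,  and the recurrence
--   Σ_{j ≤ k} j_F m j = - m (k+1)
-- (induction on k, using π (k+1) = π k (k_F - 1)) closes the induction.
-- Summing μ(0̂, x) t^{n - r(x)} level by level then gives the formula.
module Submission where

open import Defs
open import Data.Nat using (ℕ; _<_)
open import Data.Integer using (ℤ)
open import Relation.Binary.PropositionalEquality using (_≡_)

open import Data.Nat using (zero; suc; _∸_; _≤_; _<ᵇ_; z≤n; s≤s)
import Data.Nat.Properties as ℕP
open import Data.Integer using (+_; -_; _+_; _*_; _-_; _^_)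
import Data.Integer.Properties as ℤP
open import Data.Integer.Tactic.RingSolver using (solve-∀)
open import Data.Bool using (true; false; if_then_else_)
open import Data.Fin using (Fin)
open import Data.List using (List; []; _∷_; map; concatMap; applyUpTo; upTo; allFin; length; _++_)
import Data.List.Properties as ListP
open import Data.Product using (_,_; proj₁; _×_)
open import Data.Sum using (inj₁; inj₂)
open import Data.Empty using (⊥-elim)
open import Relation.Nullary using (Dec; yes; no; ¬_)
open import Relation.Nullary.Decidable using (_×-dec_; ¬?)
open import Relation.Binary.PropositionalEquality
  using (refl; sym; trans; cong; cong₂; subst; module ≡-Reasoning)
open ≡-Reasoning

-- Σ_{j<n} g j and Π_{j<n} g j, unfolded from the left so that they match
-- the lists applyUpTo f n = f 0 ∷ f 1 ∷ … ∷ f (n-1).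
sumUpTo : (ℕ → ℤ) → ℕ → ℤ
sumUpTo g zero    = + 0
sumUpTo g (suc n) = g 0 + sumUpTo (λ j → g (suc j)) n

prodUpTo : (ℕ → ℤ) → ℕ → ℤ
prodUpTo g zero    = + 1
prodUpTo g (suc n) = g 0 * prodUpTo (λ j → g (suc j)) n

map-applyUpTo : {A B : Set} (h : A → B) (f : ℕ → A) (n : ℕ) →
  map h (applyUpTo f n) ≡ applyUpTo (λ j → h (f j)) n
map-applyUpTo h f zero    = refl
map-applyUpTo h f (suc n) = cong (h (f 0) ∷_) (map-applyUpTo h (λ j → f (suc j)) n)

sumℤ-applyUpTo : (g : ℕ → ℤ) (n : ℕ) → sumℤ (applyUpTo g n) ≡ sumUpTo g n
sumℤ-applyUpTo g zero    = refl
sumℤ-applyUpTo g (suc n) = cong (λ q → g 0 + q) (sumℤ-applyUpTo (λ j → g (suc j)) n)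

prodℤ-applyUpTo : (g : ℕ → ℤ) (n : ℕ) → prodℤ (applyUpTo g n) ≡ prodUpTo g n
prodℤ-applyUpTo g zero    = refl
prodℤ-applyUpTo g (suc n) = cong (g 0 *_) (prodℤ-applyUpTo (λ j → g (suc j)) n)

map-suc-upTo : (g : ℕ → ℤ) (n : ℕ) → map g (map suc (upTo n)) ≡ applyUpTo (λ j → g (suc j)) n
map-suc-upTo g n = trans (cong (map g) (map-applyUpTo suc (λ j → j) n)) (map-applyUpTo g suc n)

sumℤ-from-1 : (g : ℕ → ℤ) (n : ℕ) → sumℤ (map g (map suc (upTo n))) ≡ sumUpTo (λ j → g (suc j)) n
sumℤ-from-1 g n = trans (cong sumℤ (map-suc-upTo g n)) (sumℤ-applyUpTo _ n)

prodℤ-from-1 : (g : ℕ → ℤ) (n : ℕ) → prodℤ (map g (map suc (upTo n))) ≡ prodUpTo (λ j → g (suc j)) n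
prodℤ-from-1 g n = trans (cong prodℤ (map-suc-upTo g n)) (prodℤ-applyUpTo _ n)

sumUpTo-snoc : (g : ℕ → ℤ) (n : ℕ) → sumUpTo g (suc n) ≡ sumUpTo g n + g n
sumUpTo-snoc g zero    = trans (ℤP.+-identityʳ (g 0)) (sym (ℤP.+-identityˡ (g 0)))
sumUpTo-snoc g (suc n) =
  trans (cong (λ q → g 0 + q) (sumUpTo-snoc (λ j → g (suc j)) n)) (sym (ℤP.+-assoc (g 0) _ _))

prodUpTo-snoc : (g : ℕ → ℤ) (n : ℕ) → prodUpTo g (suc n) ≡ prodUpTo g n * g n
prodUpTo-snoc g zero    = trans (ℤP.*-identityʳ (g 0)) (sym (ℤP.*-identityˡ (g 0)))
prodUpTo-snoc g (suc n) =
  trans (cong (g 0 *_) (prodUpTo-snoc (λ j → g (suc j)) n)) (sym (ℤP.*-assoc (g 0) _ _))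

sumUpTo-cong : {g h : ℕ → ℤ} (n : ℕ) → (∀ j → j < n → g j ≡ h j) → sumUpTo g n ≡ sumUpTo h n
sumUpTo-cong zero    eq = refl
sumUpTo-cong (suc n) eq =
  cong₂ _+_ (eq 0 (s≤s z≤n)) (sumUpTo-cong n (λ j j<n → eq (suc j) (s≤s j<n)))

below : ℕ → (ℕ → ℤ) → ℕ → ℤ
below k h j = if j <ᵇ k then h j else + 0

below-< : ∀ k h j → j < k → below k h j ≡ h j
below-< k h j j<k with j <ᵇ k | ℕP.<⇒<ᵇ j<k
... | true | _ = refl

below-≮ : ∀ k h j → ¬ j < k → below k h j ≡ + 0
below-≮ k h j j≮k with j <ᵇ k | ℕP.<ᵇ⇒< j k
... | true  | j<k = ⊥-elim (j≮k (j<k _))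
... | false | _   = refl

sumUpTo-below : ∀ k N (w h : ℕ → ℤ) → k ≤ N →
  sumUpTo (λ j → w j * below k h j) N ≡ sumUpTo (λ j → w j * h j) k
sumUpTo-below zero    N       w h _ = vanish w N
  where
    vanish : (w : ℕ → ℤ) (N : ℕ) → sumUpTo (λ j → w j * + 0) N ≡ + 0
    vanish w zero    = refl
    vanish w (suc N) = cong₂ _+_ (ℤP.*-zeroʳ (w 0)) (vanish (λ j → w (suc j)) N)
sumUpTo-below (suc k) (suc N) w h (s≤s k≤N) =
  cong (λ q → w 0 * h 0 + q) (sumUpTo-below k N (λ j → w (suc j)) (λ j → h (suc j)) k≤N)

sumℤ-cong : {A : Set} {g h : A → ℤ} → (∀ z → g z ≡ h z) → (xs : List A) →
  sumℤ (map g xs) ≡ sumℤ (map h xs)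
sumℤ-cong eq []       = refl
sumℤ-cong eq (x ∷ xs) = cong₂ _+_ (eq x) (sumℤ-cong eq xs)

sumℤ-++ : {A : Set} (g : A → ℤ) (xs ys : List A) →
  sumℤ (map g (xs ++ ys)) ≡ sumℤ (map g xs) + sumℤ (map g ys)
sumℤ-++ g []       ys = sym (ℤP.+-identityˡ _)
sumℤ-++ g (x ∷ xs) ys =
  trans (cong (λ q → g x + q) (sumℤ-++ g xs ys)) (sym (ℤP.+-assoc (g x) _ _))

sumℤ-concatMap : {A B : Set} (g : B → ℤ) (f : A → List B) (xs : List A) →
  sumℤ (map g (concatMap f xs)) ≡ sumℤ (map (λ x → sumℤ (map g (f x))) xs)
sumℤ-concatMap g f []       = refl
sumℤ-concatMap g f (x ∷ xs) =
  trans (sumℤ-++ g (f x) (concatMap f xs)) (cong (_+_ (sumℤ (map g (f x)))) (sumℤ-concatMap g f xs))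

sumℤ-const : {A : Set} (g : A → ℤ) (c : ℤ) → (∀ z → g z ≡ c) → (xs : List A) →
  sumℤ (map g xs) ≡ + length xs * c
sumℤ-const g c eq []       = sym (ℤP.*-zeroˡ c)
sumℤ-const g c eq (x ∷ xs) = begin
    g x + sumℤ (map g xs)         ≡⟨ cong₂ _+_ (eq x) (sumℤ-const g c eq xs) ⟩
    c + + length xs * c           ≡⟨ cong (_+ + length xs * c) (sym (ℤP.*-identityˡ c)) ⟩
    + 1 * c + + length xs * c     ≡⟨ sym (ℤP.*-distribʳ-+ c (+ 1) (+ length xs)) ⟩
    + suc (length xs) * c         ∎

ifDec : {P : Set} → Dec P → ℤ → ℤ
ifDec (yes _) v = v
ifDec (no _)  v = + 0

sumℤ-filterD : {A : Set} {P : A → Set} (p : (a : A) → Dec (P a)) (g : A → ℤ) (xs : List A) →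
  sumℤ (map g (filterD p xs)) ≡ sumℤ (map (λ z → ifDec (p z) (g z)) xs)
sumℤ-filterD p g []       = refl
sumℤ-filterD p g (a ∷ xs) with p a
... | yes _ = cong (λ q → g a + q) (sumℤ-filterD p g xs)
... | no _  = trans (sumℤ-filterD p g xs) (sym (ℤP.+-identityˡ _))

length-concatMap-nonempty : {A B : Set} (f : A → List B) → (∀ x → 1 ≤ length (f x)) →
  (xs : List A) → length xs ≤ length (concatMap f xs)
length-concatMap-nonempty f ne []       = z≤n
length-concatMap-nonempty f ne (x ∷ xs) =
  subst (suc (length xs) ≤_) (sym (ListP.length-++ (f x)))
        (ℕP.+-mono-≤ (ne x) (length-concatMap-nonempty f ne xs))

Fin1-unique : ∀ {c} → c ≡ 1 → (i j : Fin c) → i ≡ j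
Fin1-unique refl Fin.zero Fin.zero = refl

module CobwebProof (F : ℕ → ℕ) (F-pos : ∀ k → 0 < F k) (F0 : F 0 ≡ 1) where
  open Cobweb F

  0̂ : Elem
  0̂ = bot F0

  0̂-unique : (i : Fin (F 0)) → (0 , i) ≡ 0̂
  0̂-unique i = cong (0 ,_) (Fin1-unique F0 i _)

  level : ℕ → List Elem
  level k = map (k ,_) (allFin (F k))

  length-level : ∀ k → length (level k) ≡ F k
  length-level k = trans (ListP.length-map _ (allFin (F k))) (ListP.length-tabulate {n = F k} (λ i → i))

  sum-by-rank : ∀ n (g : Elem → ℤ) (G : ℕ → ℤ) → (∀ j → j < suc n → ∀ i → g (j , i) ≡ G j) →
    sumℤ (map g (elemsP n)) ≡ sumUpTo (λ j → + F j * G j) (suc n)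
  sum-by-rank n g G eq = begin
      sumℤ (map g (elemsP n))
    ≡⟨ sumℤ-concatMap g level (upTo (suc n)) ⟩
      sumℤ (map levelSum (upTo (suc n)))
    ≡⟨ cong sumℤ (map-applyUpTo levelSum (λ j → j) (suc n)) ⟩
      sumℤ (applyUpTo levelSum (suc n))
    ≡⟨ sumℤ-applyUpTo levelSum (suc n) ⟩
      sumUpTo levelSum (suc n)
    ≡⟨ sumUpTo-cong (suc n) levelSum-const ⟩
      sumUpTo (λ j → + F j * G j) (suc n) ∎
    where
      levelSum : ℕ → ℤ
      levelSum j = sumℤ (map g (level j))
      levelSum-const : ∀ j → j < suc n → levelSum j ≡ + F j * G j
      levelSum-const j j<n = begin
          sumℤ (map g (level j))
        ≡⟨ cong sumℤ (sym (ListP.map-∘ {g = g} {f = j ,_} (allFin (F j)))) ⟩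
          sumℤ (map (λ i → g (j , i)) (allFin (F j)))
        ≡⟨ sumℤ-const _ (G j) (eq j j<n) (allFin (F j)) ⟩
          + length (allFin (F j)) * G j
        ≡⟨ cong (λ ℓ → + ℓ * G j) (ListP.length-tabulate {n = F j} (λ i → i)) ⟩
          + F j * G j ∎

  -- P_n has at least n+1 elements, so its own size is enough fuel for μ.
  rank-<-size : ∀ n → suc n ≤ length (elemsP n)
  rank-<-size n = subst (_≤ length (elemsP n)) (ListP.length-applyUpTo (λ j → j) (suc n))
    (length-concatMap-nonempty level (λ k → subst (1 ≤_) (sym (length-level k)) (F-pos k))
                               (upTo (suc n)))

  π : ℕ → ℤ
  π k = prodℤ (map (λ r → + F r - + 1) (map suc (upTo (k ∸ 1))))

  m : ℕ → ℤ
  m k = ((- + 1) ^ k) * π k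

  π-step : ∀ k → π (suc (suc k)) ≡ π (suc k) * (+ F (suc k) - + 1)
  π-step k = begin
      π (suc (suc k))
    ≡⟨ asProd (suc k) ⟩
      prodUpTo φ (suc k)
    ≡⟨ prodUpTo-snoc φ k ⟩
      prodUpTo φ k * (+ F (suc k) - + 1)
    ≡⟨ cong (_* (+ F (suc k) - + 1)) (sym (asProd k)) ⟩
      π (suc k) * (+ F (suc k) - + 1) ∎
    where
      φ : ℕ → ℤ
      φ j = + F (suc j) - + 1
      asProd : ∀ k → π (suc k) ≡ prodUpTo φ k
      asProd = prodℤ-from-1 (λ r → + F r - + 1)

  m-recurrence : ∀ k → sumUpTo (λ j → + F j * m j) (suc k) ≡ - m (suc k)
  m-recurrence zero rewrite F0 = refl
  m-recurrence (suc k) = begin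
      sumUpTo w (suc (suc k))
    ≡⟨ sumUpTo-snoc w (suc k) ⟩
      sumUpTo w (suc k) + w (suc k)
    ≡⟨ cong (_+ w (suc k)) (m-recurrence k) ⟩
      - m (suc k) + + F (suc k) * m (suc k)
    ≡⟨ algebra ((- + 1) ^ suc k) (π (suc k)) (+ F (suc k)) ⟩
      - (((- + 1) * ((- + 1) ^ suc k)) * (π (suc k) * (+ F (suc k) - + 1)))
    ≡⟨ cong (λ q → - (((- + 1) * ((- + 1) ^ suc k)) * q)) (sym (π-step k)) ⟩
      - m (suc (suc k)) ∎
    where
      w : ℕ → ℤ
      w j = + F j * m j
      algebra : (s p f : ℤ) → - (s * p) + f * (s * p) ≡ - (((- + 1) * s) * (p * (f - + 1)))
      algebra = solve-∀

  module Möbius (n : ℕ) where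
    open Mobius _≟Π_ _≤Π_ _≤Π?_ (elemsP n)

    interval? : (y z : Elem) → Dec ((0̂ ≤Π z) × ((z ≤Π y) × ¬ (z ≡ y)))
    interval? y z = (0̂ ≤Π? z) ×-dec ((z ≤Π? y) ×-dec ¬? (z ≟Π y))

    μ-from-0̂ : ∀ f y → rank y < f → rank y ≤ n → μ-fuel f 0̂ y ≡ m (rank y)
    μ-from-0̂ (suc f) (zero , i) _ _ with 0̂ ≟Π (zero , i)
    ... | yes _  = refl
    ... | no 0̂≢y = ⊥-elim (0̂≢y (sym (0̂-unique i)))
    μ-from-0̂ (suc f) (suc k , i) (s≤s k<f) k<n with 0̂ ≟Π (suc k , i) | 0̂ ≤Π? (suc k , i)
    ... | yes 0̂≡y | _        = ⊥-elim (ℕP.0≢1+n (cong proj₁ 0̂≡y))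
    ... | no _    | no 0̂≰y  = ⊥-elim (0̂≰y (inj₁ (s≤s z≤n)))
    ... | no _    | yes _    = begin
        - sumℤ (map (μ-fuel f 0̂) (filterD (interval? y) (elemsP n)))
      ≡⟨ cong -_ (sumℤ-filterD (interval? y) (μ-fuel f 0̂) (elemsP n)) ⟩
        - sumℤ (map (λ z → ifDec (interval? y z) (μ-fuel f 0̂ z)) (elemsP n))
      ≡⟨ cong -_ (sumℤ-cong term (elemsP n)) ⟩
        - sumℤ (map (λ z → below (suc k) m (rank z)) (elemsP n))
      ≡⟨ cong -_ (sum-by-rank n _ (below (suc k) m) (λ _ _ _ → refl)) ⟩
        - sumUpTo (λ j → + F j * below (suc k) m j) (suc n)
      ≡⟨ cong -_ (sumUpTo-below (suc k) (suc n) (λ j → + F j) m (ℕP.m≤n⇒m≤1+n k<n)) ⟩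
        - sumUpTo (λ j → + F j * m j) (suc k)
      ≡⟨ cong -_ (m-recurrence k) ⟩
        - (- m (suc k))
      ≡⟨ ℤP.neg-involutive (m (suc k)) ⟩
        m (suc k) ∎
      where
        y : Elem
        y = (suc k , i)
        lower-in-interval : ∀ z → rank z < suc k → (0̂ ≤Π z) × ((z ≤Π y) × ¬ (z ≡ y))
        lower-in-interval (zero  , i′) lt =
          inj₂ (sym (0̂-unique i′)) , inj₁ lt , λ z≡y → ℕP.<-irrefl (cong proj₁ z≡y) lt
        lower-in-interval (suc j , i′) lt =
          inj₁ (s≤s z≤n) , inj₁ lt , λ z≡y → ℕP.<-irrefl (cong proj₁ z≡y) lt
        term : ∀ z → ifDec (interval? y z) (μ-fuel f 0̂ z) ≡ below (suc k) m (rank z)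
        term z with interval? y z
        ... | yes (_ , inj₁ lt , _) =
          trans (μ-from-0̂ f z (ℕP.≤-trans lt k<f) (ℕP.≤-trans (ℕP.≤-pred lt) (ℕP.<⇒≤ k<n)))
                (sym (below-< (suc k) m (rank z) lt))
        ... | yes (_ , inj₂ z≡y , z≢y) = ⊥-elim (z≢y z≡y)
        ... | no ∉ = sym (below-≮ (suc k) m (rank z) (λ lt → ∉ (lower-in-interval z lt)))

  χ-formula : ∀ n t → χ F0 n t ≡ rhs n t
  χ-formula n t = begin
      χ F0 n t
    ≡⟨ sum-by-rank n _ (λ j → m j * (t ^ (n ∸ j))) μ-level ⟩
      sumUpTo (λ j → + F j * (m j * (t ^ (n ∸ j)))) (suc n)
    ≡⟨ cong₂ _+_ bottom (sumUpTo-cong n (λ j _ → rearrange ((- + 1) ^ suc j) (+ F (suc j))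
                                                            (t ^ (n ∸ suc j)) (π (suc j)))) ⟩
      (t ^ n) + sumUpTo _ n
    ≡⟨ cong (_+_ (t ^ n)) (sym (sumℤ-from-1 _ n)) ⟩
      rhs n t ∎
    where
      μ-level : ∀ j → j < suc n → ∀ i → μP n 0̂ (j , i) * (t ^ (n ∸ j)) ≡ m j * (t ^ (n ∸ j))
      μ-level j j≤n i = cong (_* (t ^ (n ∸ j)))
        (Möbius.μ-from-0̂ n (length (elemsP n)) (j , i)
          (ℕP.≤-trans j≤n (rank-<-size n)) (ℕP.≤-pred j≤n))
      bottom : + F 0 * (m 0 * (t ^ n)) ≡ t ^ n
      bottom rewrite F0 = trans (ℤP.*-identityˡ _) (ℤP.*-identityˡ _)
      rearrange : (s f u p : ℤ) → f * ((s * p) * u) ≡ (s * f) * (u * p)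
      rearrange = solve-∀

mainTheorem3 : (F : ℕ → ℕ) → (∀ k → 0 < F k) → (F0 : F 0 ≡ 1) →
    (n : ℕ) → (t : ℤ) → Cobweb.χ F F0 n t ≡ Cobweb.rhs F n t
mainTheorem3 F F-pos F0 = CobwebProof.χ-formula F F-pos F0
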